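{- Let $G$ be a digraph, $S\subseteq V(G)$, and let $U_1,U_2$ be a partition of $V(G)-S$ such that $S$ guards $U_2$ in $G$. Let $\mathcal D_1=(T_1,\mathcal W_1)$ be a directed path decomposition of $G[U_1]$ and $\mathcal D_2=(T_2,\mathcal W_2)$ a directed path decomposition of $G[U_2]$. Let $\mathcal D=(T,\mathcal W)$ be defined by: $T$ is the union of $T_1$ and $T_2$ plus an arc from the unique sink of $T_1$ to the unique root of $T_2$; for each node $i$ of $T$, $W_i$ is the union of $S$ with the bag of $i$ in $\mathcal D_1$ or $\mathcal D_2$ (whichever contains $i$). Then $\mathcal D$ is a directed path decomposition of $G$.
   Context: All digraphs are finite and simple; $G[U]$ is the subdigraph induced by $U$. For $W,X\subseteq V(G)$, $X$ guards $W$ if $W\cap X=\emptyset$ and every arc $(u,v)$ of $G$ with $u\in W$ has $v\in W\cup X$. A directed path graph is a DAG with nodes $1,\dots,l$ and arcs exactly $(i,i+1)$, $1\le i<l$ (root $1$, sink $l$). For $H$ a digraph, a directed path decomposition of $H$ is a directed path graph $T$ on nodes $1,\dots,l$ with subsets $W_1,\dots,W_l\subseteq V(H)$ such that: (1) $\bigcup_iW_i=V(H)$; (2) $W_i\cap W_k\subseteq W_j$ for $i\le j\le k$; (3) for $1\le i<l$, $W_i\cap W_{i+1}$ guards $W_{\ge i+1}\setminus W_i$ in $H$ (where $W_{\ge i}=\bigcup_{k\ge i}W_k$), and $W_{\ge 1}$ is guarded by $\emptyset$. -}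

module Defs where

open import Data.Nat using (ℕ; zero; suc; _+_)
open import Data.Fin using (Fin; toℕ; splitAt) renaming (_≤_ to _≤ᶠ_)
open import Data.Bool using (Bool; true; false; _∨_; _∧_; T)
open import Data.Unit using (tt)
open import Data.Empty using (⊥)
open import Data.Product using (Σ; ∃; _×_; _,_)
open import Data.Sum using (_⊎_; [_,_]′)
open import Relation.Nullary using (¬_)
open import Relation.Binary.PropositionalEquality using (_≡_)

-- A (simple) digraph on vertex type V: an irreflexive arc relation.
-- Simple: at most one arc (u,v) per ordered pair (arcs form a relation), no loops.
record Digraph (V : Set) : Set₁ where
  field
    Arc      : V → V → Set
    loopless : ∀ v → ¬ Arc v v
open Digraph public

Subset : Set → Set
Subset V = V → Bool

infix 4 _∈_
_∈_ : {V : Set} → V → Subset V → Set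
v ∈ X = T (X v)

_∪ₛ_ : {V : Set} → Subset V → Subset V → Subset V
(X ∪ₛ Y) v = X v ∨ Y v

_∩ₛ_ : {V : Set} → Subset V → Subset V → Subset V
(X ∩ₛ Y) v = X v ∧ Y v

∅ₛ : {V : Set} → Subset V
∅ₛ v = false

-- X guards W in H: W ∩ X = ∅ and every arc (u,v) with u ∈ W has v ∈ W ∪ X.
-- W, X given as predicates (W may be e.g. a union over bags).
Guards : {V : Set} → Digraph V → (X W : V → Set) → Set
Guards H X W =
  (∀ v → W v → X v → ⊥) ×
  (∀ u v → Arc H u v → W u → W v ⊎ X v)

VertexOf : {V : Set} → Subset V → Set
VertexOf {V} U = Σ V (λ v → v ∈ U)

Induced : {V : Set} → Digraph V → (U : Subset V) → Digraph (VertexOf U)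
Induced G U = record
  { Arc      = λ { (u , _) (v , _) → Arc G u v }
  ; loopless = λ { (v , _) → loopless G v } }

-- W_{≥ i} = ⋃_{k ≥ i} W_k  (nodes 1..l of the path graph are Fin l = 0..l-1 here)
Above : {V : Set} {l : ℕ} → (Fin l → Subset V) → Fin l → V → Set
Above {l = l} W i v = ∃ λ (k : Fin l) → i ≤ᶠ k × v ∈ W k

-- Directed path decomposition of H: directed path graph on nodes 0 < 1 < … < l-1
-- (arcs (i,i+1)), with bags W i.
record IsDirectedPathDecomposition {V : Set} (H : Digraph V) (l : ℕ)
                                   (W : Fin l → Subset V) : Set where
  field
    nonempty  : Fin l      -- T has at least one node (a root)
    cover     : ∀ v → ∃ λ (i : Fin l) → v ∈ W i
    interpol  : ∀ (i j k : Fin l) → i ≤ᶠ j → j ≤ᶠ k →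
                ∀ v → v ∈ W i → v ∈ W k → v ∈ W j
    guardStep : ∀ (i j : Fin l) → toℕ j ≡ suc (toℕ i) →
                Guards H (λ v → v ∈ (W i ∩ₛ W j))
                         (λ v → Above W j v × ¬ (v ∈ W i))
    guardRoot : ∀ (r : Fin l) → toℕ r ≡ 0 →
                Guards H (λ v → v ∈ ∅ₛ {V}) (Above W r)

record IsPartitionOfComplement {V : Set} (S U₁ U₂ : Subset V) : Set where
  field
    covers    : ∀ v → ¬ (v ∈ S) → v ∈ U₁ ⊎ v ∈ U₂
    U₁-avoidS : ∀ v → v ∈ U₁ → ¬ (v ∈ S)
    U₂-avoidS : ∀ v → v ∈ U₂ → ¬ (v ∈ S)
    disjoint  : ∀ v → v ∈ U₁ → ¬ (v ∈ U₂)

liftAux : (b : Bool) → (T b → Bool) → Bool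
liftAux true  f = f tt
liftAux false f = false

lift : {V : Set} (U : Subset V) → Subset (VertexOf U) → Subset V
lift U X v = liftAux (U v) (λ p → X (v , p))

-- The combined decomposition: T = T₁, then an arc from the sink of T₁ to the
-- root of T₂, then T₂; i.e. nodes 0..l₁-1 are T₁'s, nodes l₁..l₁+l₂-1 are T₂'s.
combinedBags : {V : Set} (S U₁ U₂ : Subset V) {l₁ l₂ : ℕ} →
               (Fin l₁ → Subset (VertexOf U₁)) → (Fin l₂ → Subset (VertexOf U₂)) →
               Fin (l₁ + l₂) → Subset V
combinedBags S U₁ U₂ {l₁} W₁ W₂ i =
  [ (λ a → S ∪ₛ lift U₁ (W₁ a)) , (λ b → S ∪ₛ lift U₂ (W₂ b)) ]′ (splitAt l₁ i)

-- Vertices of S lie in every bag, so they never obstruct interpolation or guarding. A vertex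
-- outside S lives in bags of one side only, so interpolation and the guard condition at a
-- step inside T₁ or T₂ are inherited from the corresponding decomposition. The remaining
-- arcs lead from U₁ into U₂, or from U₂ through the junction T₁ → T₂: since S guards U₂,
-- their heads lie in S or in U₂, and every vertex of U₂ sits in some bag of T₂, i.e. after
-- the current step and in no bag of T₁.
module Submission where

open import Defs
open import Data.Nat using (ℕ; suc; z≤n; _+_; _≤_; _<_)
open import Data.Nat.Properties
  using (+-suc; +-monoʳ-≤; +-cancelˡ-≤; +-cancelˡ-≡; m≤m+n; n≤1+n; <⇒≱; <-≤-trans)
open import Data.Fin using (Fin; toℕ; splitAt; _↑ˡ_; _↑ʳ_) renaming (_≤_ to _≤ᶠ_)
open import Data.Fin.Properties using (toℕ-↑ˡ; toℕ-↑ʳ; toℕ<n; splitAt-↑ˡ; splitAt-↑ʳ; splitAt⁻¹-↑ˡ; splitAt⁻¹-↑ʳ)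
open import Data.Bool using (Bool; true; T)
open import Data.Bool.Properties using (T-∨; T-∧)
open import Data.Unit using (tt)
open import Data.Empty using (⊥-elim)
open import Data.Product using (∃; _×_; _,_; proj₁; proj₂)
open import Data.Sum using (_⊎_; inj₁; inj₂; [_,_]′)
open import Function using (_∘_)
open import Function.Bundles using (Equivalence)
open import Relation.Nullary using (¬_; yes; no)
open import Relation.Nullary.Decidable using (T?)
open import Relation.Binary.PropositionalEquality using (_≡_; sym; cong; subst; subst₂; module ≡-Reasoning)

open Equivalence using (to; from)

module _ {V : Set} {U : Subset V} {X : Subset (VertexOf U)} {v : V} where

  -- `T true` is the unit type, so membership in `lift U X` does not depend on the proof of `v ∈ U`.
  ∈-lift⁺ : (p : v ∈ U) → (v , p) ∈ X → v ∈ lift U X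
  ∈-lift⁺ = go (U v) (λ p → X (v , p))
    where
    go : (b : Bool) (f : T b → Bool) (p : T b) → T (f p) → T (liftAux b f)
    go true f _ x = x

  ∈-lift⁻ : (p : v ∈ U) → v ∈ lift U X → (v , p) ∈ X
  ∈-lift⁻ = go (U v) (λ p → X (v , p))
    where
    go : (b : Bool) (f : T b → Bool) (p : T b) → T (liftAux b f) → T (f p)
    go true f _ x = x

  lift⊆ : v ∈ lift U X → v ∈ U
  lift⊆ = go (U v) (λ p → X (v , p))
    where
    go : (b : Bool) (f : T b → Bool) → T (liftAux b f) → T b
    go true f _ = tt

  module _ {S : Subset V} where

    ∈-∪-lift⁺ : (p : v ∈ U) → (v , p) ∈ X → v ∈ S ∪ₛ lift U X
    ∈-∪-lift⁺ p = from T-∨ ∘ inj₂ ∘ ∈-lift⁺ p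

    ∈-∪-lift⁻ : ¬ v ∈ S → (p : v ∈ U) → v ∈ S ∪ₛ lift U X → (v , p) ∈ X
    ∈-∪-lift⁻ v∉S p = [ ⊥-elim ∘ v∉S , ∈-lift⁻ p ]′ ∘ to T-∨

    ∉-∪-lift : ¬ v ∈ S → ¬ v ∈ U → ¬ v ∈ S ∪ₛ lift U X
    ∉-∪-lift v∉S v∉U = [ v∉S , v∉U ∘ lift⊆ ]′ ∘ to T-∨

suc⇒≤ᶠ : ∀ {m} {i j : Fin m} → toℕ j ≡ suc (toℕ i) → i ≤ᶠ j
suc⇒≤ᶠ {i = i} j≡1+i = subst (toℕ i ≤_) (sym j≡1+i) (n≤1+n (toℕ i))

Fresh : {V : Set} {L : ℕ} → (Fin L → Subset V) → Fin L → Fin L → V → Set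
Fresh W i j v = Above W j v × ¬ v ∈ W i

-- A decomposition of G[U] whose bags, enlarged by S, occupy the nodes o, o+1, … of a longer path.
module Shifted {V : Set} (G : Digraph V) (S U : Subset V) (U-avoidS : ∀ v → v ∈ U → ¬ v ∈ S)
    {L : ℕ} (W : Fin L → Subset V)
    {l : ℕ} {W′ : Fin l → Subset (VertexOf U)} (D : IsDirectedPathDecomposition (Induced G U) l W′)
    (o : ℕ) (e : Fin l → Fin L) (toℕ-e : ∀ a → toℕ (e a) ≡ o + toℕ a)
    (bag-e : ∀ a → W (e a) ≡ S ∪ₛ lift U (W′ a)) where

  private module D = IsDirectedPathDecomposition D

  S⊆bag : ∀ {a v} → v ∈ S → v ∈ W (e a)
  S⊆bag {a} {v} s = subst (v ∈_) (sym (bag-e a)) (from (T-∨ {S v}) (inj₁ s))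

  bag⁺ : ∀ {a v} (p : v ∈ U) → (v , p) ∈ W′ a → v ∈ W (e a)
  bag⁺ {a} {v} p = subst (v ∈_) (sym (bag-e a)) ∘ ∈-∪-lift⁺ {X = W′ a} {S = S} p

  bag⁻ : ∀ {a v} (p : v ∈ U) → v ∈ W (e a) → (v , p) ∈ W′ a
  bag⁻ {a} {v} p = ∈-∪-lift⁻ {X = W′ a} {S = S} (U-avoidS v p) p ∘ subst (v ∈_) (bag-e a)

  ∉-bag : ∀ {a v} → ¬ v ∈ S → ¬ v ∈ U → ¬ v ∈ W (e a)
  ∉-bag {a} {v} v∉S v∉U = ∉-∪-lift {U = U} {X = W′ a} {S = S} v∉S v∉U ∘ subst (v ∈_) (bag-e a)

  e-mono : ∀ {a b} → a ≤ᶠ b → e a ≤ᶠ e b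
  e-mono {a} {b} = subst₂ _≤_ (sym (toℕ-e a)) (sym (toℕ-e b)) ∘ +-monoʳ-≤ o

  e-reflect : ∀ {a b} → e a ≤ᶠ e b → a ≤ᶠ b
  e-reflect {a} {b} = +-cancelˡ-≤ o _ _ ∘ subst₂ _≤_ (toℕ-e a) (toℕ-e b)

  e-reflect-suc : ∀ {a b} → toℕ (e b) ≡ suc (toℕ (e a)) → toℕ b ≡ suc (toℕ a)
  e-reflect-suc {a} {b} eb≡1+ea = +-cancelˡ-≡ o _ _ (begin
    o + toℕ b        ≡⟨ sym (toℕ-e b) ⟩
    toℕ (e b)        ≡⟨ eb≡1+ea ⟩
    suc (toℕ (e a))  ≡⟨ cong suc (toℕ-e a) ⟩
    suc (o + toℕ a)  ≡⟨ sym (+-suc o (toℕ a)) ⟩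
    o + suc (toℕ a)  ∎)
    where open ≡-Reasoning

  covered : ∀ {v} → v ∈ U → ∃ λ a → v ∈ W (e a)
  covered {v} p with D.cover (v , p)
  ... | a , v∈a = a , bag⁺ p v∈a

  interpol : ∀ a b c → e a ≤ᶠ e b → e b ≤ᶠ e c → ∀ {v} (p : v ∈ U) →
             v ∈ W (e a) → v ∈ W (e c) → v ∈ W (e b)
  interpol a b c ea≤eb eb≤ec p v∈a v∈c =
    bag⁺ p (D.interpol a b c (e-reflect ea≤eb) (e-reflect eb≤ec) _ (bag⁻ p v∈a) (bag⁻ p v∈c))

  guard : ∀ a b c → toℕ (e b) ≡ suc (toℕ (e a)) → ∀ {u v} → Arc G u v → (p : u ∈ U) (q : v ∈ U) →
          e b ≤ᶠ e c → u ∈ W (e c) → ¬ u ∈ W (e a) →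
          Fresh W (e a) (e b) v ⊎ v ∈ (W (e a) ∩ₛ W (e b))
  guard a b c eb≡1+ea uv p q eb≤ec u∈c u∉a
    with proj₂ (D.guardStep a b (e-reflect-suc eb≡1+ea)) (_ , p) (_ , q) uv
               ((c , e-reflect eb≤ec , bag⁻ p u∈c) , u∉a ∘ bag⁺ p)
  ... | inj₁ ((d , b≤d , v∈d) , v∉a) = inj₁ ((e d , e-mono b≤d , bag⁺ q v∈d) , v∉a ∘ bag⁻ q)
  ... | inj₂ v∈a∩b = let v∈a , v∈b = to T-∧ v∈a∩b in inj₂ (from T-∧ (bag⁺ q v∈a , bag⁺ q v∈b))

module Concatenation {n : ℕ} (G : Digraph (Fin n)) (S U₁ U₂ : Subset (Fin n))
    (P : IsPartitionOfComplement S U₁ U₂)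
    (S-guards-U₂ : Guards G (λ v → v ∈ S) (λ v → v ∈ U₂))
    {l₁ : ℕ} {W₁ : Fin l₁ → Subset (VertexOf U₁)} (D₁ : IsDirectedPathDecomposition (Induced G U₁) l₁ W₁)
    {l₂ : ℕ} {W₂ : Fin l₂ → Subset (VertexOf U₂)} (D₂ : IsDirectedPathDecomposition (Induced G U₂) l₂ W₂) where

  private module P = IsPartitionOfComplement P

  W : Fin (l₁ + l₂) → Subset (Fin n)
  W = combinedBags S U₁ U₂ W₁ W₂

  bag-↑ˡ : ∀ a → W (a ↑ˡ l₂) ≡ S ∪ₛ lift U₁ (W₁ a)
  bag-↑ˡ a = cong [ _ , _ ]′ (splitAt-↑ˡ l₁ a l₂)

  bag-↑ʳ : ∀ b → W (l₁ ↑ʳ b) ≡ S ∪ₛ lift U₂ (W₂ b)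
  bag-↑ʳ b = cong [ _ , _ ]′ (splitAt-↑ʳ l₁ l₂ b)

  module Part₁ = Shifted G S U₁ P.U₁-avoidS W D₁ 0 (_↑ˡ l₂) (λ a → toℕ-↑ˡ a l₂) bag-↑ˡ
  module Part₂ = Shifted G S U₂ P.U₂-avoidS W D₂ l₁ (l₁ ↑ʳ_) (toℕ-↑ʳ l₁) bag-↑ʳ

  data Left : Fin (l₁ + l₂) → Set where
    left : ∀ a → Left (a ↑ˡ l₂)

  data Right : Fin (l₁ + l₂) → Set where
    right : ∀ b → Right (l₁ ↑ʳ b)

  side : ∀ i → Left i ⊎ Right i
  side i with splitAt l₁ i in eq
  ... | inj₁ a = inj₁ (subst Left (splitAt⁻¹-↑ˡ eq) (left a))
  ... | inj₂ b = inj₂ (subst Right (splitAt⁻¹-↑ʳ eq) (right b))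

  ↑ˡ<↑ʳ : ∀ (a : Fin l₁) (b : Fin l₂) → toℕ (a ↑ˡ l₂) < toℕ (l₁ ↑ʳ b)
  ↑ˡ<↑ʳ a b = subst₂ _<_ (sym (toℕ-↑ˡ a l₂)) (sym (toℕ-↑ʳ l₁ b)) (<-≤-trans (toℕ<n a) (m≤m+n l₁ (toℕ b)))

  left-downward : ∀ {i j} → i ≤ᶠ j → Left j → Left i
  left-downward {i} i≤j (left b) with side i
  ... | inj₁ i-left    = i-left
  ... | inj₂ (right c) = ⊥-elim (<⇒≱ (↑ˡ<↑ʳ b c) i≤j)

  right-upward : ∀ {i j} → i ≤ᶠ j → Right i → Right j
  right-upward {j = j} i≤j (right b) with side j
  ... | inj₂ j-right  = j-right
  ... | inj₁ (left c) = ⊥-elim (<⇒≱ (↑ˡ<↑ʳ c b) i≤j)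

  S⊆W : ∀ {i v} → v ∈ S → v ∈ W i
  S⊆W {i} s with side i
  ... | inj₁ (left a)  = Part₁.S⊆bag s
  ... | inj₂ (right b) = Part₂.S⊆bag s

  U₁-left : ∀ {i v} → v ∈ U₁ → v ∈ W i → Left i
  U₁-left {i} {v} p v∈i with side i
  ... | inj₁ i-left    = i-left
  ... | inj₂ (right b) = ⊥-elim (Part₂.∉-bag (P.U₁-avoidS v p) (P.disjoint v p) v∈i)

  U₂-right : ∀ {i v} → v ∈ U₂ → v ∈ W i → Right i
  U₂-right {i} {v} q v∈i with side i
  ... | inj₂ i-right  = i-right
  ... | inj₁ (left a) = ⊥-elim (Part₁.∉-bag (P.U₂-avoidS v q) (λ p → P.disjoint v p q) v∈i)

  U₂-fresh : ∀ {i j v} → toℕ j ≡ suc (toℕ i) → Left i → v ∈ U₂ → Fresh W i j v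
  U₂-fresh {v = v} j≡1+i (left a) q with Part₂.covered q
  ... | c , v∈c = (l₁ ↑ʳ c , subst (_≤ toℕ (l₁ ↑ʳ c)) (sym j≡1+i) (↑ˡ<↑ʳ a c) , v∈c)
                , Part₁.∉-bag (P.U₂-avoidS v q) (λ p → P.disjoint v p q)

  cover : ∀ v → ∃ λ i → v ∈ W i
  cover v with T? (S v)
  ... | yes s = IsDirectedPathDecomposition.nonempty D₁ ↑ˡ l₂ , S⊆W s
  ... | no v∉S with P.covers v v∉S
  ...   | inj₁ p = let a , v∈a = Part₁.covered p  in a ↑ˡ l₂ , v∈a
  ...   | inj₂ q = let b , v∈b = Part₂.covered q in l₁ ↑ʳ b , v∈b

  interpol : ∀ i j k → i ≤ᶠ j → j ≤ᶠ k → ∀ v → v ∈ W i → v ∈ W k → v ∈ W j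
  interpol i j k i≤j j≤k v v∈i v∈k with T? (S v)
  ... | yes s = S⊆W s
  ... | no v∉S with P.covers v v∉S
  ...   | inj₁ p with U₁-left p v∈i | U₁-left p v∈k
  ...     | left a | left c with left-downward j≤k (left c)
  ...       | left b = Part₁.interpol a b c i≤j j≤k p v∈i v∈k
  interpol i j k i≤j j≤k v v∈i v∈k | no v∉S | inj₂ q with U₂-right q v∈i | U₂-right q v∈k
  ...     | right a | right c with right-upward i≤j (right a)
  ...       | right b = Part₂.interpol a b c i≤j j≤k q v∈i v∈k

  fresh-closed : ∀ {i j} → toℕ j ≡ suc (toℕ i) → ∀ {u v} → Arc G u v →
                 Fresh W i j u → Fresh W i j v ⊎ v ∈ (W i ∩ₛ W j)
  fresh-closed {i} j≡1+i {u} {v} uv ((k , j≤k , u∈k) , u∉i) with T? (S v)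
  ... | yes s = inj₂ (from T-∧ (S⊆W s , S⊆W s))
  ... | no v∉S with P.covers u (u∉i ∘ S⊆W)
  ...   | inj₁ p with U₁-left p u∈k
  ...     | left c with left-downward j≤k (left c)
  ...       | left b with left-downward (suc⇒≤ᶠ j≡1+i) (left b)
  ...         | left a with P.covers v v∉S
  ...           | inj₁ p′ = Part₁.guard a b c j≡1+i uv p p′ j≤k u∈k u∉i
  ...           | inj₂ q′ = inj₁ (U₂-fresh j≡1+i (left a) q′)
  fresh-closed {i} j≡1+i {u} {v} uv ((k , j≤k , u∈k) , u∉i) | no v∉S | inj₂ q
    with proj₂ S-guards-U₂ u v uv q
  ...     | inj₂ s  = ⊥-elim (v∉S s)
  ...     | inj₁ q′ with side i
  ...       | inj₁ i-left = inj₁ (U₂-fresh j≡1+i i-left q′)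
  ...       | inj₂ (right a) with right-upward (suc⇒≤ᶠ j≡1+i) (right a) | U₂-right q u∈k
  ...         | right b | right c = Part₂.guard a b c j≡1+i uv q q′ j≤k u∈k u∉i

  above-root : ∀ {r} → toℕ r ≡ 0 → ∀ v → Above W r v
  above-root r≡0 v = let k , v∈k = cover v in k , subst (_≤ toℕ k) (sym r≡0) z≤n , v∈k

  isDirectedPathDecomposition : IsDirectedPathDecomposition G (l₁ + l₂) W
  isDirectedPathDecomposition = record
    { nonempty  = IsDirectedPathDecomposition.nonempty D₁ ↑ˡ l₂
    ; cover     = cover
    ; interpol  = interpol
    ; guardStep = λ i j j≡1+i →
        (λ v v-fresh v∈i∩j → proj₂ v-fresh (proj₁ (to T-∧ v∈i∩j))) ,
        (λ u v uv → fresh-closed j≡1+i uv)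
    ; guardRoot = λ r r≡0 → (λ _ _ ()) , (λ u v _ _ → inj₁ (above-root r≡0 v))
    }

mainTheorem12 : {n : ℕ} (G : Digraph (Fin n)) (S U₁ U₂ : Subset (Fin n)) →
    IsPartitionOfComplement S U₁ U₂ →
    Guards G (λ v → v ∈ S) (λ v → v ∈ U₂) →
    (l₁ : ℕ) (W₁ : Fin l₁ → Subset (VertexOf U₁)) →
    IsDirectedPathDecomposition (Induced G U₁) l₁ W₁ →
    (l₂ : ℕ) (W₂ : Fin l₂ → Subset (VertexOf U₂)) →
    IsDirectedPathDecomposition (Induced G U₂) l₂ W₂ →
    IsDirectedPathDecomposition G (l₁ + l₂) (combinedBags S U₁ U₂ W₁ W₂)
mainTheorem12 G S U₁ U₂ P S-guards-U₂ l₁ W₁ D₁ l₂ W₂ D₂ =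
  Concatenation.isDirectedPathDecomposition G S U₁ U₂ P S-guards-U₂ D₁ D₂
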